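{- For any two words $u,v$ over a totally ordered alphabet $\mathcal A$, $u\equiv_t v$ if and only if $\mathcal P(u)=\mathcal P(v)$. That is, the taïga classes are exactly the fibers of $\mathcal P$.
   Context: The sylvester congruence $\equiv_{sylv}$ on $\mathcal A^*$ is the congruence generated by $u\cdot ac\cdot w\cdot b\cdot v\equiv_{sylv} u\cdot ca\cdot w\cdot b\cdot v$ for all words $u,w,v$ and letters $a\le b<c$. The stalactic congruence $\equiv_{stal}$ is generated by $u\cdot ba\cdot v\cdot b\cdot w\equiv_{stal}u\cdot ab\cdot v\cdot b\cdot w$ for all words $u,v,w$ and letters $a,b$. The taïga congruence $\equiv_t$ is their union $\equiv_{sylv}\vee\equiv_{stal}$, i.e. the smallest congruence containing both (the transitive closure of their union). A binary search tree with multiplicities (BSTM) is a planar binary tree whose nodes are labelled by pairs $(l,k)$ of a letter $l\in\mathcal A$ and a positive integer multiplicity $k$, such that forgetting multiplicities gives a binary search tree (letters in the left subtree of a node are smaller than its letter, letters in the right subtree larger) and each letter appears at most once. Insertion of a letter $l$ into a BSTM $t$: if $t$ is empty, return the single node $(l,1)$; if the root letter equals $l$, increment the root multiplicity; if $l$ is smaller than the root letter, insert $l$ recursively into the left subtree; otherwise insert it recursively into the right subtree. $\mathcal P(w)$ is the BSTM obtained by inserting the letters of $w$ one by one, reading $w$ from right to left, starting from the empty tree. -}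

module Defs where

open import Level using (Level)
open import Data.Nat using (ℕ; suc)
open import Data.Sum using (_⊎_)
open import Data.List using (List; []; _∷_; _++_; foldr)
open import Relation.Binary.Structures using (IsStrictTotalOrder)
open import Relation.Binary.PropositionalEquality using (_≡_)
open import Relation.Binary.Definitions using (Tri; tri<; tri≈; tri>)
open import Relation.Binary.Construct.Closure.Equivalence using (EqClosure)

module Taiga {c ℓ : Level} {A : Set c} {_<_ : A → A → Set ℓ}
             (ord : IsStrictTotalOrder _≡_ _<_) where
  open IsStrictTotalOrder ord using (compare)

  _≤_ : A → A → Set (c Level.⊔ ℓ)
  a ≤ b = (a < b) ⊎ (a ≡ b)

  Word : Set c
  Word = List A

  data SylvStep : Word → Word → Set (c Level.⊔ ℓ) where
    sylv : ∀ (u w v : Word) (a b c' : A) → a ≤ b → b < c' →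
           SylvStep (u ++ (a ∷ c' ∷ w) ++ (b ∷ v)) (u ++ (c' ∷ a ∷ w) ++ (b ∷ v))

  data StalStep : Word → Word → Set c where
    stal : ∀ (u v w : Word) (a b : A) →
           StalStep (u ++ (b ∷ a ∷ v) ++ (b ∷ w)) (u ++ (a ∷ b ∷ v) ++ (b ∷ w))

  -- the generating steps are already closed under left/right multiplication
  -- by words, so the congruences are their equivalence closures
  _≡sylv_ : Word → Word → Set _
  _≡sylv_ = EqClosure SylvStep

  _≡stal_ : Word → Word → Set _
  _≡stal_ = EqClosure StalStep

  data TaigaStep (x y : Word) : Set (c Level.⊔ ℓ) where
    viaSylv : SylvStep x y → TaigaStep x y
    viaStal : StalStep x y → TaigaStep x y

  _≡t_ : Word → Word → Set _
  _≡t_ = EqClosure TaigaStep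

  -- binary search trees with multiplicities; a node stores a letter and
  -- multiplicity (suc k) for the stored k, so multiplicities are positive
  data BSTM : Set c where
    leaf : BSTM
    node : BSTM → A → ℕ → BSTM → BSTM

  insert : A → BSTM → BSTM
  insert l leaf = node leaf l 0 leaf
  insert l (node L x k R) with compare l x
  ... | tri< _ _ _ = node (insert l L) x k R
  ... | tri≈ _ _ _ = node L x (suc k) R
  ... | tri> _ _ _ = node L x k (insert l R)

  P : Word → BSTM
  P = foldr insert leaf

-- P (u ++ s) is obtained from P s by
-- inserting the letters of u, so it suffices that each defining relation,
-- applied at the front of a suffix s' = w · b · v, leaves P unchanged.  Both
-- relations reduce to one commutation fact: if a ≤ b ≤ d and b already occurs
-- in a tree T, then inserting a and d into T commutes, because b separates
-- the two insertion paths.  In P (w · b · v) the letter b is always present.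
--
-- Every tree T has a canonical reading
-- read T = read L · read R · x^(k+1).  We show w ≡t read (P w) by induction on
-- w; the inductive step says that prepending a letter a to read T is
-- congruent to reading insert a T.  Going down the tree, a either joins the
-- copies of the root x (a stalactic move) or, when a > x, jumps over the
-- letters of read L, all of which lie below x (sylvester moves).  Two words
-- with the same tree are then congruent to the same canonical reading.
module Submission where

open import Defs
open import Level using (Level; _⊔_)
open import Relation.Binary.Structures using (IsStrictTotalOrder)
open import Relation.Binary.PropositionalEquality
  using (_≡_; refl; sym; trans; cong; subst; subst₂; isEquivalence; module ≡-Reasoning)
open import Data.Product using (_×_; _,_)
open import Data.Nat using (suc)
open import Data.Sum using (inj₁; inj₂)
open import Data.Empty using (⊥-elim)
open import Data.Unit.Polymorphic using (⊤; tt)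
open import Data.List using ([]; _∷_; _++_; foldr; replicate)
open import Data.List.Properties using (foldr-++; ++-assoc)
open import Data.List.Relation.Unary.All using (All; []; _∷_) renaming (map to All-map)
open import Data.List.Relation.Unary.All.Properties using (++⁺; ++⁻)
open import Relation.Binary.Definitions using (Tri; tri<; tri≈; tri>)
open import Relation.Binary.Construct.Closure.Equivalence using (gfold; gmap; symmetric)
open import Relation.Binary.Construct.Closure.ReflexiveTransitive using (ε; _◅_; _◅◅_)
open import Relation.Binary.Construct.Closure.Symmetric using (fwd; bwd)

module TaigaFibres {c ℓ : Level} {A : Set c} {_<_ : A → A → Set ℓ}
                   (ord : IsStrictTotalOrder _≡_ _<_) where
  open Taiga ord
  open IsStrictTotalOrder ord using (compare) renaming (trans to <-trans)
  open ≡-Reasoning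

  ≤-<-trans : ∀ {a b d} → a ≤ b → b < d → a < d
  ≤-<-trans (inj₁ a<b) b<d = <-trans a<b b<d
  ≤-<-trans (inj₂ refl) b<d = b<d

  <-≤-trans : ∀ {a b d} → a < b → b ≤ d → a < d
  <-≤-trans a<b (inj₁ b<d) = <-trans a<b b<d
  <-≤-trans a<b (inj₂ refl) = a<b

  insert-< : ∀ {l x L k R} → l < x → insert l (node L x k R) ≡ node (insert l L) x k R
  insert-< {l} {x} l<x with compare l x
  ... | tri< _ _ _ = refl
  ... | tri≈ l≮x _ _ = ⊥-elim (l≮x l<x)
  ... | tri> l≮x _ _ = ⊥-elim (l≮x l<x)

  insert-≡ : ∀ {x L k R} → insert x (node L x k R) ≡ node L x (suc k) R
  insert-≡ {x} with compare x x
  ... | tri< _ x≢x _ = ⊥-elim (x≢x refl)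
  ... | tri≈ _ _ _ = refl
  ... | tri> _ x≢x _ = ⊥-elim (x≢x refl)

  insert-> : ∀ {l x L k R} → x < l → insert l (node L x k R) ≡ node L x k (insert l R)
  insert-> {l} {x} x<l with compare l x
  ... | tri< _ _ x≮l = ⊥-elim (x≮l x<l)
  ... | tri≈ _ _ x≮l = ⊥-elim (x≮l x<l)
  ... | tri> _ _ _ = refl

  -- Insertions of letters a ≤ x ≤ d into a tree with root x commute: one
  -- acts on the left subtree or the root count, the other on the root count
  -- or the right subtree.
  insert-commute-at-root : ∀ {a d x L k R} → a ≤ x → x ≤ d →
    insert a (insert d (node L x k R)) ≡ insert d (insert a (node L x k R))
  insert-commute-at-root {a} {d} {x} {L} {k} {R} (inj₁ a<x) (inj₁ x<d) = begin
    insert a (insert d (node L x k R))   ≡⟨ cong (insert a) (insert-> x<d) ⟩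
    insert a (node L x k (insert d R))   ≡⟨ insert-< a<x ⟩
    node (insert a L) x k (insert d R)   ≡⟨ insert-> x<d ⟨
    insert d (node (insert a L) x k R)   ≡⟨ cong (insert d) (insert-< a<x) ⟨
    insert d (insert a (node L x k R))   ∎
  insert-commute-at-root {a} {_} {x} {L} {k} {R} (inj₁ a<x) (inj₂ refl) = begin
    insert a (insert x (node L x k R))   ≡⟨ cong (insert a) insert-≡ ⟩
    insert a (node L x (suc k) R)        ≡⟨ insert-< a<x ⟩
    node (insert a L) x (suc k) R        ≡⟨ insert-≡ ⟨
    insert x (node (insert a L) x k R)   ≡⟨ cong (insert x) (insert-< a<x) ⟨
    insert x (insert a (node L x k R))   ∎
  insert-commute-at-root {_} {d} {x} {L} {k} {R} (inj₂ refl) (inj₁ x<d) = begin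
    insert x (insert d (node L x k R))   ≡⟨ cong (insert x) (insert-> x<d) ⟩
    insert x (node L x k (insert d R))   ≡⟨ insert-≡ ⟩
    node L x (suc k) (insert d R)        ≡⟨ insert-> x<d ⟨
    insert d (node L x (suc k) R)        ≡⟨ cong (insert d) insert-≡ ⟨
    insert d (insert x (node L x k R))   ∎
  insert-commute-at-root (inj₂ refl) (inj₂ refl) = refl

  data _∈ᵀ_ (b : A) : BSTM → Set (c ⊔ ℓ) where
    here  : ∀ {L k R} → b ∈ᵀ node L b k R
    left  : ∀ {L x k R} → b < x → b ∈ᵀ L → b ∈ᵀ node L x k R
    right : ∀ {L x k R} → x < b → b ∈ᵀ R → b ∈ᵀ node L x k R

  -- Along the search path of b, the
  -- two letters travel together until they reach a node separating them.
  insert-commute : ∀ {a b d} T → b ∈ᵀ T → a ≤ b → b ≤ d →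
                   insert a (insert d T) ≡ insert d (insert a T)
  insert-commute _ here a≤b b≤d = insert-commute-at-root a≤b b≤d
  insert-commute {a} {b} {d} (node L x k R) (left b<x b∈L) a≤b b≤d =
    via-left (compare d x)
    where
    a<x : a < x
    a<x = ≤-<-trans a≤b b<x
    -- a goes left; d goes left too (induction) or is separated from a by x
    via-left : Tri (d < x) (d ≡ x) (x < d) →
               insert a (insert d (node L x k R)) ≡ insert d (insert a (node L x k R))
    via-left (tri< d<x _ _) = begin
      insert a (insert d (node L x k R))   ≡⟨ cong (insert a) (insert-< d<x) ⟩
      insert a (node (insert d L) x k R)   ≡⟨ insert-< a<x ⟩
      node (insert a (insert d L)) x k R   ≡⟨ cong (λ t → node t x k R) (insert-commute L b∈L a≤b b≤d) ⟩
      node (insert d (insert a L)) x k R   ≡⟨ insert-< d<x ⟨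
      insert d (node (insert a L) x k R)   ≡⟨ cong (insert d) (insert-< a<x) ⟨
      insert d (insert a (node L x k R))   ∎
    via-left (tri≈ _ d≡x _) = insert-commute-at-root (inj₁ a<x) (inj₂ (sym d≡x))
    via-left (tri> _ _ x<d) = insert-commute-at-root (inj₁ a<x) (inj₁ x<d)
  insert-commute {a} {b} {d} (node L x k R) (right x<b b∈R) a≤b b≤d =
    via-right (compare a x)
    where
    x<d : x < d
    x<d = <-≤-trans x<b b≤d
    -- d goes right; a goes right too (induction) or is separated from d by x
    via-right : Tri (a < x) (a ≡ x) (x < a) →
                insert a (insert d (node L x k R)) ≡ insert d (insert a (node L x k R))
    via-right (tri< a<x _ _) = insert-commute-at-root (inj₁ a<x) (inj₁ x<d)
    via-right (tri≈ _ a≡x _) = insert-commute-at-root (inj₂ a≡x) (inj₁ x<d)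
    via-right (tri> _ _ x<a) = begin
      insert a (insert d (node L x k R))   ≡⟨ cong (insert a) (insert-> x<d) ⟩
      insert a (node L x k (insert d R))   ≡⟨ insert-> x<a ⟩
      node L x k (insert a (insert d R))   ≡⟨ cong (node L x k) (insert-commute R b∈R a≤b b≤d) ⟩
      node L x k (insert d (insert a R))   ≡⟨ insert-> x<d ⟨
      insert d (node L x k (insert a R))   ≡⟨ cong (insert d) (insert-> x<a) ⟨
      insert d (insert a (node L x k R))   ∎

  -- Stalactic form: inserting any letter a commutes with inserting a letter b
  -- that is already present (b itself is the separator).
  insert-commute-present : ∀ a b T → b ∈ᵀ T → insert b (insert a T) ≡ insert a (insert b T)
  insert-commute-present a b T b∈T with compare a b
  ... | tri< a<b _ _ = sym (insert-commute T b∈T (inj₁ a<b) (inj₂ refl))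
  ... | tri≈ _ refl _ = refl
  ... | tri> _ _ b<a = insert-commute T b∈T (inj₂ refl) (inj₁ b<a)

  ∈ᵀ-insert : ∀ {b} a T → b ∈ᵀ T → b ∈ᵀ insert a T
  ∈ᵀ-insert a (node L x k R) b∈T with compare a x | b∈T
  ... | tri< _ _ _ | here          = here
  ... | tri< _ _ _ | left b<x b∈L  = left b<x (∈ᵀ-insert a L b∈L)
  ... | tri< _ _ _ | right x<b b∈R = right x<b b∈R
  ... | tri≈ _ _ _ | here          = here
  ... | tri≈ _ _ _ | left b<x b∈L  = left b<x b∈L
  ... | tri≈ _ _ _ | right x<b b∈R = right x<b b∈R
  ... | tri> _ _ _ | here          = here
  ... | tri> _ _ _ | left b<x b∈L  = left b<x b∈L
  ... | tri> _ _ _ | right x<b b∈R = right x<b (∈ᵀ-insert a R b∈R)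

  ∈ᵀ-insert-self : ∀ b T → b ∈ᵀ insert b T
  ∈ᵀ-insert-self b leaf = here
  ∈ᵀ-insert-self b (node L x k R) with compare b x
  ... | tri< b<x _ _ = left b<x (∈ᵀ-insert-self b L)
  ... | tri≈ _ refl _ = here
  ... | tri> _ _ x<b = right x<b (∈ᵀ-insert-self b R)

  ∈ᵀ-insertAll : ∀ {b} (v : Word) T → b ∈ᵀ T → b ∈ᵀ foldr insert T v
  ∈ᵀ-insertAll [] T b∈T = b∈T
  ∈ᵀ-insertAll (a ∷ v) T b∈T = ∈ᵀ-insert a _ (∈ᵀ-insertAll v T b∈T)

  P-++ : ∀ u s → P (u ++ s) ≡ foldr insert (P s) u
  P-++ u s = foldr-++ insert leaf u s

  ∈ᵀ-P : ∀ b v w → b ∈ᵀ P (v ++ b ∷ w)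
  ∈ᵀ-P b v w = subst (b ∈ᵀ_) (sym (P-++ v (b ∷ w))) (∈ᵀ-insertAll v _ (∈ᵀ-insert-self b (P w)))

  P-under-prefix : ∀ u {s t} → P s ≡ P t → P (u ++ s) ≡ P (u ++ t)
  P-under-prefix u {s} {t} eq = begin
    P (u ++ s)              ≡⟨ P-++ u s ⟩
    foldr insert (P s) u    ≡⟨ cong (λ T → foldr insert T u) eq ⟩
    foldr insert (P t) u    ≡⟨ P-++ u t ⟨
    P (u ++ t)              ∎

  P-step : ∀ {x y} → TaigaStep x y → P x ≡ P y
  P-step (viaSylv (sylv u w v a b d a≤b b<d)) =
    P-under-prefix u (insert-commute (P (w ++ b ∷ v)) (∈ᵀ-P b w v) a≤b (inj₁ b<d))
  P-step (viaStal (stal u v w a b)) =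
    P-under-prefix u (insert-commute-present a b (P (v ++ b ∷ w)) (∈ᵀ-P b v w))

  P-sound : ∀ {u v} → u ≡t v → P u ≡ P v
  P-sound = gfold isEquivalence P P-step

  step-prepend : ∀ y {s t} → TaigaStep s t → TaigaStep (y ∷ s) (y ∷ t)
  step-prepend y (viaSylv (sylv u w v a b d a≤b b<d)) = viaSylv (sylv (y ∷ u) w v a b d a≤b b<d)
  step-prepend y (viaStal (stal u v w a b)) = viaStal (stal (y ∷ u) v w a b)

  prepend : ∀ y {s t} → s ≡t t → (y ∷ s) ≡t (y ∷ t)
  prepend y = gmap (y ∷_) (step-prepend y)

  prepend* : ∀ u {s t} → s ≡t t → (u ++ s) ≡t (u ++ t)
  prepend* [] e = e
  prepend* (y ∷ u) e = prepend y (prepend* u e)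

  -- Bracketing needed to push a suffix r inside a generating relation.
  reassoc : ∀ (u m : Word) b v r → (u ++ m ++ b ∷ v) ++ r ≡ u ++ m ++ b ∷ (v ++ r)
  reassoc u m b v r = trans (++-assoc u (m ++ b ∷ v) r) (cong (u ++_) (++-assoc m (b ∷ v) r))

  step-append : ∀ r {s t} → TaigaStep s t → TaigaStep (s ++ r) (t ++ r)
  step-append r (viaSylv (sylv u w v a b d a≤b b<d)) =
    subst₂ TaigaStep (sym (reassoc u (a ∷ d ∷ w) b v r)) (sym (reassoc u (d ∷ a ∷ w) b v r))
      (viaSylv (sylv u w (v ++ r) a b d a≤b b<d))
  step-append r (viaStal (stal u v w a b)) =
    subst₂ TaigaStep (sym (reassoc u (b ∷ a ∷ v) b w r)) (sym (reassoc u (a ∷ b ∷ v) b w r))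
      (viaStal (stal u v (w ++ r) a b))

  append : ∀ r {s t} → s ≡t t → (s ++ r) ≡t (t ++ r)
  append r = gmap (_++ r) (step-append r)

  stalactic-move : ∀ x s r → (x ∷ s ++ x ∷ r) ≡t (s ++ x ∷ x ∷ r)
  stalactic-move x [] r = ε
  stalactic-move x (y ∷ s) r =
    fwd (viaStal (stal [] s r y x)) ◅ prepend y (stalactic-move x s r)

  sylvester-move : ∀ {x d} → x < d → ∀ {s} → All (_≤ x) s → ∀ t r →
                   (d ∷ s ++ t ++ x ∷ r) ≡t (s ++ d ∷ t ++ x ∷ r)
  sylvester-move x<d [] t r = ε
  sylvester-move {x} {d} x<d {y ∷ s} (y≤x ∷ s≤x) t r =
    bwd (subst (λ z → TaigaStep (y ∷ d ∷ z) (d ∷ y ∷ z)) (++-assoc s t (x ∷ r))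
               (viaSylv (sylv [] (s ++ t) r y x d y≤x x<d)))
    ◅ prepend y (sylvester-move x<d s≤x t r)

  read : BSTM → Word
  read leaf = []
  read (node L x k R) = read L ++ read R ++ x ∷ replicate k x

  -- The half of the search-tree invariant the completeness argument uses:
  -- at every node, all letters of the left subtree are below the root.
  LeftBounded : BSTM → Set (c ⊔ ℓ)
  LeftBounded leaf = ⊤
  LeftBounded (node L x k R) = LeftBounded L × LeftBounded R × All (_< x) (read L)

  All-read-insert : ∀ {q} {Q : A → Set q} a T → All Q (read T) → Q a → All Q (read (insert a T))
  All-read-insert a leaf _ Qa = Qa ∷ []
  All-read-insert a (node L x k R) QT Qa with ++⁻ (read L) QT
  ... | QL , QRx with ++⁻ (read R) QRx | compare a x
  ... | QR , Qx | tri< _ _ _  = ++⁺ (All-read-insert a L QL Qa) QRx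
  ... | QR , Qx | tri≈ _ refl _ = ++⁺ QL (++⁺ QR (Qa ∷ Qx))
  ... | QR , Qx | tri> _ _ _  = ++⁺ QL (++⁺ (All-read-insert a R QR Qa) Qx)

  LeftBounded-insert : ∀ a T → LeftBounded T → LeftBounded (insert a T)
  LeftBounded-insert a leaf _ = tt , tt , []
  LeftBounded-insert a (node L x k R) (bL , bR , L<x) with compare a x
  ... | tri< a<x _ _ = LeftBounded-insert a L bL , bR , All-read-insert a L L<x a<x
  ... | tri≈ _ refl _ = bL , bR , L<x
  ... | tri> _ _ _ = bL , LeftBounded-insert a R bR , L<x

  LeftBounded-P : ∀ w → LeftBounded (P w)
  LeftBounded-P [] = tt
  LeftBounded-P (a ∷ w) = LeftBounded-insert a (P w) (LeftBounded-P w)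

  read-insert : ∀ a T → LeftBounded T → (a ∷ read T) ≡t read (insert a T)
  read-insert a leaf _ = ε
  read-insert a (node L x k R) (bL , bR , L<x) with compare a x
  ... | tri< _ _ _ = append (read R ++ x ∷ replicate k x) (read-insert a L bL)
  ... | tri≈ _ refl _ =
    subst₂ _≡t_ (cong (x ∷_) (++-assoc (read L) (read R) (x ∷ replicate k x)))
                (++-assoc (read L) (read R) (x ∷ x ∷ replicate k x))
                (stalactic-move x (read L ++ read R) (replicate k x))
  ... | tri> _ _ x<a =
    sylvester-move x<a (All-map inj₁ L<x) (read R) (replicate k x)
    ◅◅ prepend* (read L) (append (x ∷ replicate k x) (read-insert a R bR))

  ≡t-read-P : ∀ w → w ≡t read (P w)
  ≡t-read-P [] = ε
  ≡t-read-P (a ∷ w) = prepend a (≡t-read-P w) ◅◅ read-insert a (P w) (LeftBounded-P w)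

  P-complete : ∀ {u v} → P u ≡ P v → u ≡t v
  P-complete {u} {v} eq =
    subst (λ T → u ≡t read T) eq (≡t-read-P u) ◅◅ symmetric TaigaStep (≡t-read-P v)

mainTheorem9 : ∀ {c ℓ : Level} {A : Set c} {_<_ : A → A → Set ℓ} (ord : IsStrictTotalOrder _≡_ _<_) → let open Taiga ord in
    ∀ (u v : Word) → ((u ≡t v → P u ≡ P v) × (P u ≡ P v → u ≡t v))
mainTheorem9 ord u v = P-sound , P-complete
  where open TaigaFibres ord
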